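{- Let $(e_k)_{k\ge0}$ be a $q$-Catalan basis associated to the Catalan power series $P$, and let $T$ be the linear operator on power series defined by $Te_k=q^ke_k$, $k\ge0$. Consider the operators $Af(z)=P(z,1)f(qz)$ and $Mf(z)=zf(z)$. Then (i) $(A,M)$ $q$-commute, i.e. $AM=qMA$; (ii) $A=P(M,T)$.
   Context: $q$ is a fixed parameter; all series are formal. A Catalan power series is a power series $P(z,t)$ with $P(z,t)=t-z\tilde P(z,t)t^2$ for some power series $\tilde P$. A family of power series $(e_k)_{k\ge0}$ is a $q$-Catalan basis associated to $P$ if $e_k(qz)/e_k(z)=P(z,q^k)/P(z,1)$ for all $k\ge0$; each $e_k$ has order $k$, so $(e_k)$ is a basis of power series. If $P(z,t)=\sum p_{ij}z^it^j$, then $P(M,T)$ denotes the operator $\sum p_{ij}M^iT^j$. -}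

module Defs where

open import Level using (Level; _⊔_)
open import Algebra.Bundles using (CommutativeRing)
open import Data.Nat using (ℕ; zero; suc; _≤_; _<_; _∸_)
open import Data.List using (List; []; _∷_)
open import Data.Product using (Σ; _×_; ∃)
open import Relation.Nullary using (¬_)

IsFieldRing : ∀ {c ℓ} → CommutativeRing c ℓ → Set (c ⊔ ℓ)
IsFieldRing R = (¬ (1# ≈ 0#)) × (∀ x → ¬ (x ≈ 0#) → Σ Carrier λ y → (x * y) ≈ 1#)
  where open CommutativeRing R

module PowerSeries {c ℓ} (R : CommutativeRing c ℓ) where
  open CommutativeRing R using (Carrier; _≈_; _+_; _*_; -_; _-_; 0#; 1#)

  PS : Set c
  PS = ℕ → Carrier

  _≋_ : PS → PS → Set ℓ
  f ≋ g = ∀ n → f n ≈ g n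

  0ˢ : PS
  0ˢ _ = 0#

  _⊕_ : PS → PS → PS
  (f ⊕ g) n = f n + g n

  _·ˢ_ : Carrier → PS → PS
  (a ·ˢ f) n = a * f n

  sumTo : ℕ → (ℕ → Carrier) → Carrier
  sumTo zero    g = g zero
  sumTo (suc n) g = sumTo n g + g (suc n)

  _⊛_ : PS → PS → PS
  (f ⊛ g) n = sumTo n (λ i → f i * g (n ∸ i))

  pow : Carrier → ℕ → Carrier
  pow a zero    = 1#
  pow a (suc k) = a * pow a k

  dilate : Carrier → PS → PS
  dilate q f n = pow q n * f n

  Mop : PS → PS
  Mop f zero    = 0#
  Mop f (suc n) = f n

  -- polynomials in t, as coefficient lists (constant term first)
  Poly : Set c
  Poly = List Carrier

  coeffPoly : Poly → ℕ → Carrier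
  coeffPoly []       _       = 0#
  coeffPoly (a ∷ as) zero    = a
  coeffPoly (a ∷ as) (suc j) = coeffPoly as j

  evalPoly : Poly → Carrier → Carrier
  evalPoly []       t = 0#
  evalPoly (a ∷ as) t = a + t * evalPoly as t

  -- series in z with polynomial-in-t coefficients:  P(z,t) = Σ_i (P i)(t) z^i
  BiSeries : Set c
  BiSeries = ℕ → Poly

  evalT : BiSeries → Carrier → PS
  evalT P a i = evalPoly (P i) a

  -- Catalan power series: P(z,t) = t - z P̃(z,t) t², written coefficientwise
  -- ([z^i t^j] of t is δ_{i0}δ_{j1}; [z^i t^j] of z P̃ t² is P̃_{i-1,j-2}).
  tCoeff : ℕ → ℕ → Carrier
  tCoeff zero (suc zero) = 1#
  tCoeff _    _          = 0#

  zt²Coeff : BiSeries → ℕ → ℕ → Carrier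
  zt²Coeff P̃ (suc i) (suc (suc j)) = coeffPoly (P̃ i) j
  zt²Coeff P̃ _       _             = 0#

  IsCatalan : BiSeries → Set (c ⊔ ℓ)
  IsCatalan P = Σ BiSeries λ P̃ →
    ∀ i j → coeffPoly (P i) j ≈ (tCoeff i j - zt²Coeff P̃ i j)

  HasOrder : PS → ℕ → Set ℓ
  HasOrder f k = (∀ n → n < k → f n ≈ 0#) × ¬ (f k ≈ 0#)

  -- q-Catalan basis associated to P:  e_k(qz)/e_k(z) = P(z,q^k)/P(z,1),
  -- stated in cleared-denominator form  e_k(qz) P(z,1) = P(z,q^k) e_k(z),
  -- together with: e_k has order k.
  IsQCatalanBasis : Carrier → BiSeries → (ℕ → PS) → Set ℓ
  IsQCatalanBasis q P e = ∀ k →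
    HasOrder (e k) k ×
    ((dilate q (e k) ⊛ evalT P 1#) ≋ (evalT P (pow q k) ⊛ e k))

  Aop : Carrier → BiSeries → PS → PS
  Aop q P f = evalT P 1# ⊛ dilate q f

  iter : ℕ → (PS → PS) → PS → PS
  iter zero    T f = f
  iter (suc j) T f = iter j T (T f)

  polyOp : Poly → (PS → PS) → PS → PS
  polyOp []       T f = 0ˢ
  polyOp (a ∷ as) T f = (a ·ˢ f) ⊕ polyOp as T (T f)

  -- P(M,T) f = Σ_i M^i (Σ_j p_ij T^j) f ; coefficient n only involves i ≤ n
  PMT : BiSeries → (PS → PS) → PS → PS
  PMT P T f n = sumTo n (λ i → polyOp (P i) T f (n ∸ i))

  IsLinear : (PS → PS) → Set (c ⊔ ℓ)
  IsLinear T =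
    (∀ f g → f ≋ g → T f ≋ T g) ×
    (∀ f g → T (f ⊕ g) ≋ (T f ⊕ T g)) ×
    (∀ a f → T (a ·ˢ f) ≋ (a ·ˢ T f))

  -- T is continuous for the z-adic topology: [z^n](T f) depends only on
  -- [z^0..z^n] f.  (This is what "linear operator defined on the basis
  -- (e_k)" means for infinite combinations Σ c_k e_k.)
  IsContinuous : (PS → PS) → Set (c ⊔ ℓ)
  IsContinuous T = ∀ f g n → (∀ m → m ≤ n → f m ≈ g m) → T f n ≈ T g n

module Submission where

-- (i) is a formal identity, independent of the basis: multiplication by z
-- commutes with Cauchy products, and dilation z ↦ qz turns M into q M.
--
-- (ii) compares [z^n](A f) with [z^n](P(M,T) f).  Both are linear in f and
-- depend only on the coefficients z^0,…,z^n of f (T is continuous).  For such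
-- functionals a triangular basis suffices: since e_m has order m with an
-- invertible leading coefficient, subtracting a multiple of e_m lets us raise
-- the order of f one step at a time until f agrees with e_{n+1} up to z^n.
-- So it suffices to check (ii) on each e_k, where T acts by the scalar q^k,
-- P(M,T) e_k = P(z,q^k) e_k, and the basis equation gives A e_k = P(z,q^k) e_k.

open import Defs
open import Level using (_⊔_)
open import Algebra.Bundles using (CommutativeRing)
open import Algebra.Solver.Ring.AlmostCommutativeRing
  using (fromCommutativeRing; -raw-almostCommutative⟶; module AlmostCommutativeRing)
open import Data.Maybe using (nothing)
open import Data.Nat using (ℕ; zero; suc; _≤_; _<_; _∸_; z≤n; s≤s)
  renaming (_+_ to _+ℕ_)
open import Data.Nat.Properties
  using (≤-refl; ≤-trans; n≤1+n; m∸n≤m; +-suc; n∸n≡0; m∸[m∸n]≡n; m≤n⇒m<n∨m≡n)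
  renaming (+-identityʳ to +ℕ-identityʳ)
open import Data.Product using (Σ; _×_; _,_; proj₁; proj₂)
open import Data.Sum using (inj₁; inj₂)
open import Data.List using ([]; _∷_)
import Relation.Binary.PropositionalEquality as PE

module _ {c ℓ} (K : CommutativeRing c ℓ) where
  open CommutativeRing K
  open PowerSeries K
  open import Algebra.Properties.Ring ring using (-‿distribˡ-*)
  open import Relation.Binary.Reasoning.Setoid setoid
  private
    ACR = fromCommutativeRing K
  open import Algebra.Solver.Ring (AlmostCommutativeRing.rawRing ACR) ACR
    (-raw-almostCommutative⟶ ACR) (λ _ _ → nothing)

  suc-∸ : ∀ {i n} → i ≤ n → suc n ∸ i PE.≡ suc (n ∸ i)
  suc-∸ z≤n     = PE.refl
  suc-∸ (s≤s p) = suc-∸ p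

  sumTo-cong : ∀ n {x y : ℕ → Carrier} → (∀ i → i ≤ n → x i ≈ y i) →
               sumTo n x ≈ sumTo n y
  sumTo-cong zero    h = h 0 z≤n
  sumTo-cong (suc n) h =
    +-cong (sumTo-cong n (λ i p → h i (≤-trans p (n≤1+n n)))) (h (suc n) ≤-refl)

  sumTo-linear : ∀ n x y a →
    sumTo n (λ i → x i + a * y i) ≈ sumTo n x + a * sumTo n y
  sumTo-linear zero    x y a = refl
  sumTo-linear (suc n) x y a = begin
    sumTo n (λ i → x i + a * y i) + (x (suc n) + a * y (suc n))
      ≈⟨ +-congʳ (sumTo-linear n x y a) ⟩
    (sumTo n x + a * sumTo n y) + (x (suc n) + a * y (suc n))
      ≈⟨ solve 5 (λ X Y A x′ y′ → (X :+ A :* Y) :+ (x′ :+ A :* y′)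
                                  := (X :+ x′) :+ A :* (Y :+ y′))
               refl (sumTo n x) (sumTo n y) a (x (suc n)) (y (suc n)) ⟩
    (sumTo n x + x (suc n)) + a * (sumTo n y + y (suc n)) ∎

  sumTo-scale : ∀ n x a → sumTo n (λ i → a * x i) ≈ a * sumTo n x
  sumTo-scale zero    x a = refl
  sumTo-scale (suc n) x a = trans (+-congʳ (sumTo-scale n x a)) (sym (distribˡ a _ _))

  sumTo-shift : ∀ n h → sumTo (suc n) h ≈ h 0 + sumTo n (λ i → h (suc i))
  sumTo-shift zero    h = refl
  sumTo-shift (suc n) h = trans (+-congʳ (sumTo-shift n h)) (+-assoc _ _ _)

  sumTo-reverse : ∀ n h → sumTo n h ≈ sumTo n (λ i → h (n ∸ i))
  sumTo-reverse zero    h = refl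
  sumTo-reverse (suc n) h = begin
    sumTo (suc n) h                              ≈⟨ sumTo-shift n h ⟩
    h 0 + sumTo n (λ i → h (suc i))              ≈⟨ +-congˡ (sumTo-reverse n (λ i → h (suc i))) ⟩
    h 0 + sumTo n (λ i → h (suc (n ∸ i)))        ≈⟨ +-comm _ _ ⟩
    sumTo n (λ i → h (suc (n ∸ i))) + h 0
      ≈⟨ +-congʳ (sumTo-cong n (λ i p → reflexive (PE.cong h (PE.sym (suc-∸ p))))) ⟩
    sumTo n (λ i → h (suc n ∸ i)) + h 0
      ≈⟨ +-congˡ (reflexive (PE.cong h (PE.sym (n∸n≡0 n)))) ⟩
    sumTo n (λ i → h (suc n ∸ i)) + h (n ∸ n) ∎

  ⊛-comm : ∀ f g → (f ⊛ g) ≋ (g ⊛ f)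
  ⊛-comm f g n = trans (sumTo-reverse n _) (sumTo-cong n (λ i p →
    trans (*-comm _ _) (reflexive (PE.cong (λ j → g j * f (n ∸ i)) (m∸[m∸n]≡n p)))))

  ⊛-congˡ : ∀ f {g h} → g ≋ h → (f ⊛ g) ≋ (f ⊛ h)
  ⊛-congˡ f g≋h n = sumTo-cong n (λ i _ → *-congˡ (g≋h (n ∸ i)))

  ⊛-scale : ∀ f g a → (f ⊛ (a ·ˢ g)) ≋ (a ·ˢ (f ⊛ g))
  ⊛-scale f g a n = trans
    (sumTo-cong n (λ i _ → trans (sym (*-assoc _ _ _))
                     (trans (*-congʳ (*-comm _ _)) (*-assoc _ _ _))))
    (sumTo-scale n _ a)

  ⊛-Mop : ∀ f g → (f ⊛ Mop g) ≋ Mop (f ⊛ g)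
  ⊛-Mop f g zero    = zeroʳ (f 0)
  ⊛-Mop f g (suc n) = begin
    sumTo n (λ i → f i * Mop g (suc n ∸ i)) + f (suc n) * Mop g (suc n ∸ suc n)
      ≈⟨ +-congˡ (trans (*-congˡ (reflexive (PE.cong (Mop g) (n∸n≡0 n)))) (zeroʳ _)) ⟩
    sumTo n (λ i → f i * Mop g (suc n ∸ i)) + 0#
      ≈⟨ +-identityʳ _ ⟩
    sumTo n (λ i → f i * Mop g (suc n ∸ i))
      ≈⟨ sumTo-cong n (λ i p → reflexive (PE.cong (λ j → f i * Mop g j) (suc-∸ p))) ⟩
    sumTo n (λ i → f i * g (n ∸ i)) ∎

  dilate-Mop : ∀ q f → dilate q (Mop f) ≋ (q ·ˢ Mop (dilate q f))
  dilate-Mop q f zero    = trans (zeroʳ _) (sym (zeroʳ q))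
  dilate-Mop q f (suc n) = *-assoc q (pow q n) (f n)

  q-commute : ∀ q P f → Aop q P (Mop f) ≋ (q ·ˢ Mop (Aop q P f))
  q-commute q P f n = begin
    (evalT P 1# ⊛ dilate q (Mop f)) n         ≈⟨ ⊛-congˡ (evalT P 1#) (dilate-Mop q f) n ⟩
    (evalT P 1# ⊛ (q ·ˢ Mop (dilate q f))) n  ≈⟨ ⊛-scale (evalT P 1#) (Mop (dilate q f)) q n ⟩
    q * (evalT P 1# ⊛ Mop (dilate q f)) n     ≈⟨ *-congˡ (⊛-Mop (evalT P 1#) (dilate q f) n) ⟩
    q * Mop (evalT P 1# ⊛ dilate q f) n       ∎

  Agree : ℕ → PS → PS → Set ℓ
  Agree n f g = ∀ m → m ≤ n → f m ≈ g m

  VanishesBelow : ℕ → PS → Set ℓ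
  VanishesBelow m f = ∀ j → j < m → f j ≈ 0#

  RespectsTrunc : ℕ → (PS → Carrier) → Set (c ⊔ ℓ)
  RespectsTrunc n Φ = ∀ f g → Agree n f g → Φ f ≈ Φ g

  IsLinearFunctional : (PS → Carrier) → Set (c ⊔ ℓ)
  IsLinearFunctional Φ = ∀ f g a → Φ (f ⊕ (a ·ˢ g)) ≈ Φ f + a * Φ g

  subtract-add : ∀ f e a → f ≋ ((f ⊕ ((- a) ·ˢ e)) ⊕ (a ·ˢ e))
  subtract-add f e a j = sym (begin
    (f j + (- a) * e j) + a * e j  ≈⟨ +-assoc _ _ _ ⟩
    f j + ((- a) * e j + a * e j)  ≈⟨ +-congˡ (sym (distribʳ _ _ _)) ⟩
    f j + (- a + a) * e j          ≈⟨ +-congˡ (trans (*-congʳ (-‿inverseˡ a)) (zeroˡ _)) ⟩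
    f j + 0#                       ≈⟨ +-identityʳ _ ⟩
    f j                            ∎)

  module _ (isField : IsFieldRing K) (e : ℕ → PS) (order : ∀ k → HasOrder (e k) k) where

    raise-order : ∀ m f → VanishesBelow m f →
                  Σ Carrier λ a → VanishesBelow (suc m) (f ⊕ ((- a) ·ˢ e m))
    raise-order m f f-van = f m * y , vanishes
      where
        y   = proj₁ (proj₂ isField (e m m) (proj₂ (order m)))
        e·y = proj₂ (proj₂ isField (e m m) (proj₂ (order m)))
        vanishes : VanishesBelow (suc m) (f ⊕ ((- (f m * y)) ·ˢ e m))
        vanishes j (s≤s j≤m) with m≤n⇒m<n∨m≡n j≤m
        ... | inj₁ j<m = begin
          f j + (- (f m * y)) * e m j  ≈⟨ +-cong (f-van j j<m) (*-congˡ (proj₁ (order m) j j<m)) ⟩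
          0# + (- (f m * y)) * 0#      ≈⟨ trans (+-identityˡ _) (zeroʳ _) ⟩
          0#                            ∎
        ... | inj₂ PE.refl = begin
          f m + (- (f m * y)) * e m m
            ≈⟨ +-congˡ (trans (sym (-‿distribˡ-* _ _))
                             (-‿cong (trans (*-assoc _ _ _) (*-congˡ (*-comm _ _))))) ⟩
          f m + (- (f m * (e m m * y)))  ≈⟨ +-congˡ (-‿cong (trans (*-congˡ e·y) (*-identityʳ _))) ⟩
          f m + (- f m)                  ≈⟨ -‿inverseʳ _ ⟩
          0#                             ∎

    -- Induction on n+1-m, where
    -- z^m divides f: when m = n+1, f agrees with e_(n+1) mod z^(n+1).
    functional-unique : ∀ n Φ Ψ →
      RespectsTrunc n Φ → RespectsTrunc n Ψ →
      IsLinearFunctional Φ → IsLinearFunctional Ψ →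
      (∀ k → Φ (e k) ≈ Ψ (e k)) → ∀ f → Φ f ≈ Ψ f
    functional-unique n Φ Ψ Φ-trunc Ψ-trunc Φ-lin Ψ-lin on-basis f =
      from (suc n) 0 f (+ℕ-identityʳ (suc n)) (λ j ())
      where
        from : ∀ d m g → d +ℕ m PE.≡ suc n → VanishesBelow m g → Φ g ≈ Ψ g
        from zero .(suc n) g PE.refl g-van = begin
          Φ g            ≈⟨ Φ-trunc g (e (suc n)) g≈e ⟩
          Φ (e (suc n))  ≈⟨ on-basis (suc n) ⟩
          Ψ (e (suc n))  ≈⟨ Ψ-trunc (e (suc n)) g (λ j p → sym (g≈e j p)) ⟩
          Ψ g            ∎
          where
            g≈e : Agree n g (e (suc n))
            g≈e j j≤n = trans (g-van j (s≤s j≤n)) (sym (proj₁ (order (suc n)) j (s≤s j≤n)))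
        from (suc d) m g eq g-van = begin
          Φ g                        ≈⟨ Φ-trunc g _ (λ j _ → subtract-add g (e m) a j) ⟩
          Φ (g′ ⊕ (a ·ˢ e m))        ≈⟨ Φ-lin g′ (e m) a ⟩
          Φ g′ + a * Φ (e m)         ≈⟨ +-cong (from d (suc m) g′ eq′ g′-van) (*-congˡ (on-basis m)) ⟩
          Ψ g′ + a * Ψ (e m)         ≈⟨ sym (Ψ-lin g′ (e m) a) ⟩
          Ψ (g′ ⊕ (a ·ˢ e m))        ≈⟨ Ψ-trunc _ g (λ j _ → sym (subtract-add g (e m) a j)) ⟩
          Ψ g                        ∎
          where
            a      = proj₁ (raise-order m g g-van)
            g′     = g ⊕ ((- a) ·ˢ e m)
            g′-van = proj₂ (raise-order m g g-van)
            eq′    = PE.trans (+-suc d m) eq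

  A-trunc : ∀ q P n → RespectsTrunc n (λ f → Aop q P f n)
  A-trunc q P n f g f≈g = sumTo-cong n (λ i _ → *-congˡ (*-congˡ (f≈g (n ∸ i) (m∸n≤m n i))))

  A-linear : ∀ q P n → IsLinearFunctional (λ f → Aop q P f n)
  A-linear q P n f g a = trans
    (sumTo-cong n (λ i _ →
      solve 5 (λ X Q F A G → X :* (Q :* (F :+ A :* G)) := X :* (Q :* F) :+ A :* (X :* (Q :* G)))
            refl (evalT P 1# i) (pow q (n ∸ i)) (f (n ∸ i)) a (g (n ∸ i))))
    (sumTo-linear n _ _ a)

  A-on-basis : ∀ q P e → IsQCatalanBasis q P e → ∀ k → Aop q P (e k) ≋ (evalT P (pow q k) ⊛ e k)
  A-on-basis q P e basis k n = trans (⊛-comm (evalT P 1#) (dilate q (e k)) n) (proj₂ (basis k) n)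

  module _ (T : PS → PS) (lin : IsLinear T) (cont : IsContinuous T) where
    private
      T-cong  = proj₁ lin
      T-⊕     = proj₁ (proj₂ lin)
      T-scale = proj₂ (proj₂ lin)

    polyOp-cong : ∀ cs {f g} → f ≋ g → polyOp cs T f ≋ polyOp cs T g
    polyOp-cong []       f≋g m = refl
    polyOp-cong (a ∷ cs) f≋g m =
      +-cong (*-congˡ (f≋g m)) (polyOp-cong cs (T-cong _ _ f≋g) m)

    polyOp-agree : ∀ cs n {f g} → Agree n f g → Agree n (polyOp cs T f) (polyOp cs T g)
    polyOp-agree []       n f≈g m m≤n = refl
    polyOp-agree (a ∷ cs) n {f} {g} f≈g m m≤n =
      +-cong (*-congˡ (f≈g m m≤n))
             (polyOp-agree cs n (λ j j≤n → cont f g j (λ i i≤j → f≈g i (≤-trans i≤j j≤n))) m m≤n)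

    polyOp-⊕ : ∀ cs f g → polyOp cs T (f ⊕ g) ≋ (polyOp cs T f ⊕ polyOp cs T g)
    polyOp-⊕ []       f g m = sym (+-identityʳ 0#)
    polyOp-⊕ (a ∷ cs) f g m = begin
      a * (f m + g m) + polyOp cs T (T (f ⊕ g)) m
        ≈⟨ +-congˡ (polyOp-cong cs (T-⊕ f g) m) ⟩
      a * (f m + g m) + polyOp cs T (T f ⊕ T g) m
        ≈⟨ +-congˡ (polyOp-⊕ cs (T f) (T g) m) ⟩
      a * (f m + g m) + (polyOp cs T (T f) m + polyOp cs T (T g) m)
        ≈⟨ solve 5 (λ A F G X Y → A :* (F :+ G) :+ (X :+ Y) := (A :* F :+ X) :+ (A :* G :+ Y))
                 refl a (f m) (g m) _ _ ⟩
      (a * f m + polyOp cs T (T f) m) + (a * g m + polyOp cs T (T g) m) ∎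

    polyOp-scale : ∀ cs f b → polyOp cs T (b ·ˢ f) ≋ (b ·ˢ polyOp cs T f)
    polyOp-scale []       f b m = sym (zeroʳ b)
    polyOp-scale (a ∷ cs) f b m = begin
      a * (b * f m) + polyOp cs T (T (b ·ˢ f)) m
        ≈⟨ +-congˡ (polyOp-cong cs (T-scale b f) m) ⟩
      a * (b * f m) + polyOp cs T (b ·ˢ T f) m
        ≈⟨ +-congˡ (polyOp-scale cs (T f) b m) ⟩
      a * (b * f m) + b * polyOp cs T (T f) m
        ≈⟨ solve 4 (λ A B F Y → A :* (B :* F) :+ B :* Y := B :* (A :* F :+ Y)) refl a b (f m) _ ⟩
      b * (a * f m + polyOp cs T (T f) m) ∎

    polyOp-eigen : ∀ cs g λ′ → T g ≋ (λ′ ·ˢ g) → polyOp cs T g ≋ (evalPoly cs λ′ ·ˢ g)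
    polyOp-eigen []       g λ′ eig m = sym (zeroˡ _)
    polyOp-eigen (a ∷ cs) g λ′ eig m = begin
      a * g m + polyOp cs T (T g) m          ≈⟨ +-congˡ (polyOp-cong cs eig m) ⟩
      a * g m + polyOp cs T (λ′ ·ˢ g) m      ≈⟨ +-congˡ (polyOp-scale cs g λ′ m) ⟩
      a * g m + λ′ * polyOp cs T g m         ≈⟨ +-congˡ (*-congˡ (polyOp-eigen cs g λ′ eig m)) ⟩
      a * g m + λ′ * (evalPoly cs λ′ * g m)  ≈⟨ +-congˡ (sym (*-assoc _ _ _)) ⟩
      a * g m + (λ′ * evalPoly cs λ′) * g m  ≈⟨ sym (distribʳ _ _ _) ⟩
      (a + λ′ * evalPoly cs λ′) * g m        ∎

    PMT-trunc : ∀ P n → RespectsTrunc n (λ f → PMT P T f n)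
    PMT-trunc P n f g f≈g = sumTo-cong n (λ i _ → polyOp-agree (P i) n f≈g (n ∸ i) (m∸n≤m n i))

    PMT-linear : ∀ P n → IsLinearFunctional (λ f → PMT P T f n)
    PMT-linear P n f g a = trans
      (sumTo-cong n (λ i _ → trans (polyOp-⊕ (P i) f (a ·ˢ g) (n ∸ i))
                                   (+-congˡ (polyOp-scale (P i) g a (n ∸ i)))))
      (sumTo-linear n _ _ a)

    PMT-eigen : ∀ P g λ′ → T g ≋ (λ′ ·ˢ g) → PMT P T g ≋ (evalT P λ′ ⊛ g)
    PMT-eigen P g λ′ eig n = sumTo-cong n (λ i _ → polyOp-eigen (P i) g λ′ eig (n ∸ i))

theorem4p7p1 : ∀ {c ℓ} (K : CommutativeRing c ℓ) → IsFieldRing K →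
    let open CommutativeRing K using (Carrier)
        open PowerSeries K
    in (q : Carrier) (P : BiSeries) (e : ℕ → PS) (T : PS → PS) →
       IsCatalan P → IsQCatalanBasis q P e →
       IsLinear T → IsContinuous T → (∀ k → T (e k) ≋ (pow q k ·ˢ e k)) →
       (∀ f → Aop q P (Mop f) ≋ (q ·ˢ Mop (Aop q P f)))
       × (∀ f → Aop q P f ≋ PMT P T f)
theorem4p7p1 K isField q P e T _ basis lin cont eig =
  q-commute K q P , A≋PMT
  where
    open CommutativeRing K using (trans; sym)
    open PowerSeries K using (_≋_; Aop; PMT; pow)

    A≋PMT : ∀ f → Aop q P f ≋ PMT P T f
    A≋PMT f n = functional-unique K isField e (λ k → proj₁ (basis k)) n _ _
      (A-trunc K q P n) (PMT-trunc K T lin cont P n)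
      (A-linear K q P n) (PMT-linear K T lin cont P n)
      (λ k → trans (A-on-basis K q P e basis k n)
                   (sym (PMT-eigen K T lin cont P (e k) (pow q k) (eig k) n)))
      f
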